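{- Let $G=(V,E)$ be a graph and let $\mathcal{M}$ be a nontrivial, unbounded graph matroid family with dimensionality $d$. Let $k\ge 2$ be an integer. If $\mathcal{M}(G)$ is vertically $k$-connected, then the minimum degree of $G$ is at least $k+d-1$. In particular, $|V|\ge k+d$.
   Context: All graphs are finite and simple, without isolated vertices. A graph matroid family $\mathcal{M}$ assigns to every graph $G$ a matroid $\mathcal{M}(G)$ on $E(G)$ such that (i) every graph isomorphism $\varphi:V(G)\to V(H)$ induces, via $uv\mapsto\varphi(u)\varphi(v)$, an isomorphism $\mathcal{M}(G)\to\mathcal{M}(H)$, and (ii) for every subgraph $H$ of $G$, $\mathcal{M}(H)$ is the restriction of $\mathcal{M}(G)$ to $E(H)$. With $r$ the rank function, $G$ is $\mathcal{M}$-independent if $r(G)=|E(G)|$ and an $\mathcal{M}$-circuit if not $\mathcal{M}$-independent but $G-e$ is for all $e\in E(G)$. $\mathcal{M}$ is trivial if every graph is $\mathcal{M}$-independent; unbounded if $r(K_n)$ is unbounded in $n$. For nontrivial $\mathcal{M}$, the dimensionality is $d=\min\{d':\exists\ \mathcal{M}\text{ -circuit with minimum degree } d'+1\}$. For a matroid $(E,r)$, a vertical $k$-separation is a bipartition $(E_1,E_2)$ of $E$ with $r(E_1),r(E_2)\ge k$ and $r(E_1)+r(E_2)\le r(E)+k-1$; the matroid is vertically $k$-connected if $k\le r(E)$ and it has no vertical $k'$-separation for any positive integer $k'<k$. -}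

module Defs where

open import Data.Nat using (ℕ; zero; suc; _+_; _≤_; _<_)
open import Data.Fin using (Fin)
open import Data.Fin.Properties using (_≟_)
open import Data.Fin.Subset using (Subset; _⊆_; _∪_; _∩_; ∣_∣; ∁; ⊤; _∈_; _∉_)
open import Data.Product using (Σ; ∃; _×_; _,_; proj₁; proj₂)
open import Data.Sum using (_⊎_)
open import Data.List using (List; length; filter)
open import Data.List.Base using ()
open import Data.Fin.Base using ()
open import Data.List using () renaming (map to lmap)
open import Data.Empty using (⊥)
open import Relation.Nullary using (¬_; Dec)
open import Relation.Nullary.Decidable using (_⊎-dec_)
open import Relation.Binary.PropositionalEquality using (_≡_; _≢_)
open import Function.Definitions using (Injective)
open import Data.List using () renaming ([] to nil)
import Data.List as L

record Matroid (m : ℕ) : Set where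
  field
    rank      : Subset m → ℕ
    rank-≤    : ∀ X → rank X ≤ ∣ X ∣
    rank-mono : ∀ X Y → X ⊆ Y → rank X ≤ rank Y
    rank-sub  : ∀ X Y → rank (X ∪ Y) + rank (X ∩ Y) ≤ rank X + rank Y
open Matroid public

SameEdge : ∀ {n} → Fin n × Fin n → Fin n × Fin n → Set
SameEdge (a , b) (c , d) = (a ≡ c × b ≡ d) ⊎ (a ≡ d × b ≡ c)

record Graph : Set where
  field
    n    : ℕ
    m    : ℕ
    ends : Fin m → Fin n × Fin n
    loopless   : ∀ e → proj₁ (ends e) ≢ proj₂ (ends e)
    simple     : ∀ e f → SameEdge (ends e) (ends f) → e ≡ f
    noIsolated : ∀ v → ∃ λ e → (proj₁ (ends e) ≡ v) ⊎ (proj₂ (ends e) ≡ v)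
open Graph public

degree : (G : Graph) → Fin (n G) → ℕ
degree G v = length (filter (λ e → (proj₁ (ends G e) ≟ v) ⊎-dec (proj₂ (ends G e) ≟ v)) (L.allFin (m G)))

Adjacent : (G : Graph) → Fin (n G) → Fin (n G) → Set
Adjacent G u v = ∃ λ e → SameEdge (ends G e) (u , v)

IsComplete : Graph → Set
IsComplete G = ∀ u v → u ≢ v → Adjacent G u v

record Embedding (H G : Graph) : Set where
  field
    φ     : Fin (n H) → Fin (n G)
    φ-inj : Injective _≡_ _≡_ φ
    ψ     : Fin (m H) → Fin (m G)
    ψ-ends : ∀ e → SameEdge (φ (proj₁ (ends H e)) , φ (proj₂ (ends H e))) (ends G (ψ e))
open Embedding public

IsImage : ∀ {a b} → (Fin a → Fin b) → Subset a → Subset b → Set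
IsImage f X Y = ∀ y → (y ∈ Y → ∃ λ x → x ∈ X × f x ≡ y) × (∀ x → x ∈ X → f x ∈ Y)

-- Conditions (i) (isomorphism invariance) and
-- (ii) (restriction to subgraphs) are combined into one condition:
-- for every embedding H → G (= isomorphism onto a subgraph), the induced
-- edge map is an isomorphism of M(H) onto the restriction of M(G).
record GraphMatroidFamily : Set where
  field
    M : (G : Graph) → Matroid (m G)
    embed-rank : ∀ H G (f : Embedding H G) (X : Subset (m H)) (Y : Subset (m G)) →
      IsImage (ψ f) X Y → rank (M H) X ≡ rank (M G) Y
open GraphMatroidFamily public

r : GraphMatroidFamily → (G : Graph) → ℕ
r 𝓜 G = rank (M 𝓜 G) ⊤

Independent : GraphMatroidFamily → Graph → Set
Independent 𝓜 G = r 𝓜 G ≡ m G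

-- the edge set of G - e, as a subset of E(G); by (ii), M(G - e) is the
-- restriction of M(G) to it, so G - e is independent iff this subset has
-- rank |E(G)| - 1 = its size.
minusEdge : ∀ {m} → Fin m → Subset m
minusEdge {m} e = ∁ (Data.Fin.Subset.⁅_⁆ e)

IsCircuit : GraphMatroidFamily → Graph → Set
IsCircuit 𝓜 G = ¬ Independent 𝓜 G ×
  (∀ e → rank (M 𝓜 G) (minusEdge e) ≡ ∣ minusEdge {m G} e ∣)

MinDegree : Graph → ℕ → Set
MinDegree G t = (∀ v → t ≤ degree G v) × (∃ λ v → degree G v ≡ t)

Trivial : GraphMatroidFamily → Set
Trivial 𝓜 = ∀ G → Independent 𝓜 G

Nontrivial : GraphMatroidFamily → Set
Nontrivial 𝓜 = ¬ Trivial 𝓜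

Unbounded : GraphMatroidFamily → Set
Unbounded 𝓜 = ∀ N → ∃ λ K → IsComplete K × N ≤ r 𝓜 K

IsDimensionality : GraphMatroidFamily → ℕ → Set
IsDimensionality 𝓜 d =
  (∃ λ C → IsCircuit 𝓜 C × MinDegree C (suc d)) ×
  (∀ d' → (∃ λ C → IsCircuit 𝓜 C × MinDegree C (suc d')) → d ≤ d')

VerticalSeparation : ∀ {m} → Matroid m → ℕ → Subset m → Set
VerticalSeparation Mt k X =
  k ≤ rank Mt X × k ≤ rank Mt (∁ X) × rank Mt X + rank Mt (∁ X) + 1 ≤ rank Mt ⊤ + k

VerticallyConnected : ∀ {m} → Matroid m → ℕ → Set
VerticallyConnected Mt k =
  k ≤ rank Mt ⊤ × (∀ k' → 1 ≤ k' → k' < k → ∀ X → ¬ VerticalSeparation Mt k' X)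

-- Suppose some vertex v had degree below k + d - 1. Split the edges at v into a set B
-- of fewer than d edges and a nonempty set A of fewer than k edges, pick e ∈ A and let
-- S = (E - A) + e. Only B + e, at most d edges, of S meet v, so a circuit through e inside
-- S would be a graph circuit with a vertex of degree at most d, against the minimality of
-- d. Hence e is a coloop of S and r(E - A) < r(E); as also r(A) ≤ |A| < k, the pair
-- (A, E - A) is a vertical k'-separation with k' = r(A) + r(E - A) - r(E) + 1 < k.
-- The argument needs d ≥ 1, and this is where unboundedness enters. A circuit C with a
-- leaf edge uw embeds into a complete graph K so that uw lands on any given edge yz with
-- z outside the first |V(C)| vertices P and all other vertices of C land in P + y.
-- Hence the edges inside P span K, and r(K) ≤ |V(C)|² for every complete K.

module Submission where

open import Defs
open import Data.Bool using (true; false)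
open import Data.Fin using (Fin; zero; suc; toℕ; inject≤; fromℕ<; combine)
open import Data.Fin.Permutation.Components using (transpose; transpose-inverse)
open import Data.Fin.Properties as Fin using (_≟_; injective⇒≤)
open import Data.Fin.Subset
open import Data.Fin.Subset.Induction using (⊂-wellFounded)
open import Data.Fin.Subset.Properties
open import Data.List as List using (length; filter; allFin)
open import Data.List.Extrema.Nat using (argmin; f[argmin]≤f[xs])
open import Data.List.Membership.Propositional.Properties using (∈-allFin)
import Data.List.Relation.Unary.All as All
open import Data.Nat
  using (ℕ; zero; suc; pred; _+_; _∸_; _*_; _≤_; _<_; z≤n; s≤s; s≤s⁻¹; z<s; _≤?_; _<?_; >-nonZero)
open import Data.Nat.Properties hiding (_≟_)
open import Data.Product using (∃; _×_; _,_; proj₁; proj₂)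
open import Data.Sum using (_⊎_; inj₁; inj₂; [_,_]′)
open import Data.Vec using (_∷_; []; here; there; tabulate)
open import Data.Vec.Properties using (lookup∘tabulate; []=⇒lookup; lookup⇒[]=)
open import Function using (_∘_; id)
open import Function.Definitions using (Injective)
import Induction.WellFounded as WF
open import Level using (Level)
open import Relation.Binary.PropositionalEquality
open import Relation.Nullary using (yes; no; does; ¬_; contradiction)
open import Relation.Nullary.Decidable using (dec-true; _×-dec_; _⊎-dec_)
open import Relation.Unary using (Pred; Decidable)

private
  variable
    ℓ : Level
    k : ℕ
    x y : Fin k
    p q : Subset k

-- Finite subsets

x∈p─q⇒x∉q : ∀ (p q : Subset k) → x ∈ p ─ q → x ∉ q
x∈p─q⇒x∉q (inside ∷ p) (outside ∷ q) here ()
x∈p─q⇒x∉q (_ ∷ p) (_ ∷ q) (there x∈p─q) (there x∈q) = x∈p─q⇒x∉q p q x∈p─q x∈q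
x∈p─q⇒x∉q (_ ∷ p) (inside ∷ q) () here

x∈p-y⇒x≢y : ∀ (p : Subset k) → x ∈ p - y → x ≢ y
x∈p-y⇒x≢y {y = y} p x∈p-y refl = x∈p─q⇒x∉q p ⁅ y ⁆ x∈p-y (x∈⁅x⁆ y)

x∈p⇒suc∣p-x∣≡∣p∣ : x ∈ p → suc ∣ p - x ∣ ≡ ∣ p ∣
x∈p⇒suc∣p-x∣≡∣p∣ {p = inside ∷ p} here = cong (suc ∘ ∣_∣) (p─⊥≡p p)
x∈p⇒suc∣p-x∣≡∣p∣ {p = inside ∷ p} (there x∈p) = cong suc (x∈p⇒suc∣p-x∣≡∣p∣ x∈p)
x∈p⇒suc∣p-x∣≡∣p∣ {p = outside ∷ p} (there x∈p) = x∈p⇒suc∣p-x∣≡∣p∣ x∈p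

suc∣∁⁅x⁆∣≡k : ∀ {k} (x : Fin k) → suc ∣ ∁ ⁅ x ⁆ ∣ ≡ k
suc∣∁⁅x⁆∣≡k {k} x = begin
  suc ∣ ∁ ⁅ x ⁆ ∣            ≡⟨ cong suc (∣∁p∣≡n∸∣p∣ ⁅ x ⁆) ⟩
  suc (k ∸ ∣ ⁅ x ⁆ ∣)        ≡⟨ cong (λ j → suc (k ∸ j)) (∣⁅x⁆∣≡1 x) ⟩
  1 + (k ∸ 1)                ≡⟨ m+[n∸m]≡n (≤-trans (s≤s z≤n) (Fin.toℕ<n x)) ⟩
  k                          ∎
  where open ≡-Reasoning

∣p∪q∣≤∣p∣+∣q∣ : ∀ (p q : Subset k) → ∣ p ∪ q ∣ ≤ ∣ p ∣ + ∣ q ∣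
∣p∪q∣≤∣p∣+∣q∣ [] [] = z≤n
∣p∪q∣≤∣p∣+∣q∣ (inside ∷ p) (inside ∷ q) =
  s≤s (≤-trans (∣p∪q∣≤∣p∣+∣q∣ p q) (+-monoʳ-≤ ∣ p ∣ (n≤1+n ∣ q ∣)))
∣p∪q∣≤∣p∣+∣q∣ (inside ∷ p) (outside ∷ q) = s≤s (∣p∪q∣≤∣p∣+∣q∣ p q)
∣p∪q∣≤∣p∣+∣q∣ (outside ∷ p) (inside ∷ q) =
  subst (suc ∣ p ∪ q ∣ ≤_) (sym (+-suc ∣ p ∣ ∣ q ∣)) (s≤s (∣p∪q∣≤∣p∣+∣q∣ p q))
∣p∪q∣≤∣p∣+∣q∣ (outside ∷ p) (outside ∷ q) = ∣p∪q∣≤∣p∣+∣q∣ p q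

∣p∣>0⇒Nonempty : ∀ {k} {p : Subset k} → 0 < ∣ p ∣ → Nonempty p
∣p∣>0⇒Nonempty {k} {p} 0<∣p∣ with nonempty? p
... | yes nonempty = nonempty
... | no empty = contradiction (trans (cong ∣_∣ (Empty-unique empty)) (∣⊥∣≡0 k)) (>⇒≢ 0<∣p∣)

∣p∣≡1⇒y≡x : ∣ p ∣ ≡ 1 → x ∈ p → y ∈ p → y ≡ x
∣p∣≡1⇒y≡x {p = p} {x = x} {y = y} ∣p∣≡1 x∈p y∈p with y ≟ x
... | yes y≡x = y≡x
... | no y≢x = contradiction (trans (x∈p⇒suc∣p-x∣≡∣p∣ (x∈p∧x≢y⇒x∈p-y y∈p y≢x)) ∣p-x∣≡0) λ ()
  where
  ∣p-x∣≡0 : ∣ p - x ∣ ≡ 0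
  ∣p-x∣≡0 = suc-injective (trans (x∈p⇒suc∣p-x∣≡∣p∣ x∈p) ∣p∣≡1)

split-by-size : ∀ {k} i j (p : Subset k) → ∣ p ∣ ≡ i + j →
  ∃ λ q → q ⊆ p × ∣ q ∣ ≡ i × ∣ p ─ q ∣ ≡ j
split-by-size {k} zero j p ∣p∣≡j = ⊥ , ⊆-min p , ∣⊥∣≡0 k , trans (cong ∣_∣ (p─⊥≡p p)) ∣p∣≡j
split-by-size (suc i) j (inside ∷ p) ∣p∣≡i+j with split-by-size i j p (suc-injective ∣p∣≡i+j)
... | q , q⊆p , ∣q∣≡i , ∣p─q∣≡j = inside ∷ q , s⊆s q⊆p , cong suc ∣q∣≡i , ∣p─q∣≡j
split-by-size (suc i) j (outside ∷ p) ∣p∣≡i+j with split-by-size (suc i) j p ∣p∣≡i+j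
... | q , q⊆p , ∣q∣≡i , ∣p─q∣≡j = outside ∷ q , s⊆s q⊆p , ∣q∣≡i , ∣p─q∣≡j

deletion-induction : (P : Pred (Subset k) ℓ) → (∀ p → (∀ {x} → x ∈ p → P (p - x)) → P p) → ∀ p → P p
deletion-induction {ℓ = ℓ} P step =
  WF.All.wfRec ⊂-wellFounded ℓ P (λ p rec → step p (λ x∈p → rec (x∈p⇒p-x⊂p x∈p)))

enum : ∀ (p : Subset k) → Fin ∣ p ∣ → Fin k
enum (inside ∷ p) zero = zero
enum (inside ∷ p) (suc i) = suc (enum p i)
enum (outside ∷ p) i = suc (enum p i)

enum-∈ : ∀ (p : Subset k) i → enum p i ∈ p
enum-∈ (inside ∷ p) zero = here
enum-∈ (inside ∷ p) (suc i) = there (enum-∈ p i)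
enum-∈ (outside ∷ p) i = there (enum-∈ p i)

enum-injective : ∀ (p : Subset k) → Injective _≡_ _≡_ (enum p)
enum-injective (inside ∷ p) {zero} {zero} _ = refl
enum-injective (inside ∷ p) {suc i} {suc j} eq = cong suc (enum-injective p (Fin.suc-injective eq))
enum-injective (outside ∷ p) eq = enum-injective p (Fin.suc-injective eq)

index : x ∈ p → Fin ∣ p ∣
index {p = inside ∷ p} here = zero
index {p = inside ∷ p} (there x∈p) = suc (index x∈p)
index {p = outside ∷ p} (there x∈p) = index x∈p

enum-index : ∀ (x∈p : x ∈ p) → enum p (index x∈p) ≡ x
enum-index {p = inside ∷ p} here = refl
enum-index {p = inside ∷ p} (there x∈p) = cong suc (enum-index x∈p)
enum-index {p = outside ∷ p} (there x∈p) = cong suc (enum-index x∈p)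

index-unique : ∀ {i} (x∈p : x ∈ p) → enum p i ≡ x → index x∈p ≡ i
index-unique {p = p} x∈p eq = enum-injective p (trans (enum-index x∈p) (sym eq))

injectiveOn⇒∣p∣≤∣q∣ : ∀ {k l} {p : Subset k} {q : Subset l} (f : Fin k → Fin l) →
  (∀ {x} → x ∈ p → f x ∈ q) → (∀ {x y} → x ∈ p → y ∈ p → f x ≡ f y → x ≡ y) →
  ∣ p ∣ ≤ ∣ q ∣
injectiveOn⇒∣p∣≤∣q∣ {p = p} {q} f f∈q f-inj = injective⇒≤ λ {i} {j} eq →
  enum-injective p (f-inj (enum-∈ p i) (enum-∈ p j) (begin
    f (enum p i)                         ≡⟨ sym (enum-index (f∈q (enum-∈ p i))) ⟩
    enum q (index (f∈q (enum-∈ p i)))    ≡⟨ cong (enum q) eq ⟩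
    enum q (index (f∈q (enum-∈ p j)))    ≡⟨ enum-index (f∈q (enum-∈ p j)) ⟩
    f (enum p j)                         ∎))
  where open ≡-Reasoning

setOf : ∀ {P : Pred (Fin k) ℓ} → Decidable P → Subset k
setOf P? = tabulate (does ∘ P?)

module _ {P : Pred (Fin k) ℓ} (P? : Decidable P) where

  ∈-setOf⁺ : P x → x ∈ setOf P?
  ∈-setOf⁺ {x = x} px =
    lookup⇒[]= x (setOf P?) (trans (lookup∘tabulate (does ∘ P?) x) (dec-true (P? x) px))

  ∈-setOf⁻ : x ∈ setOf P? → P x
  ∈-setOf⁻ {x = x} x∈ with P? x | trans (sym (lookup∘tabulate (does ∘ P?) x)) ([]=⇒lookup x∈)
  ... | yes px | _ = px

∣tabulate∣≡length-filter : ∀ {a} {A : Set a} {P : Pred A ℓ} (P? : Decidable P) (g : Fin k → A) →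
  ∣ tabulate (does ∘ P? ∘ g) ∣ ≡ length (filter P? (List.tabulate g))
∣tabulate∣≡length-filter {k = zero} P? g = refl
∣tabulate∣≡length-filter {k = suc k} P? g with does (P? (g zero)) | ∣tabulate∣≡length-filter P? (g ∘ suc)
... | true | eq = cong suc eq
... | false | eq = eq

∣setOf∣≡length-filter : ∀ {P : Pred (Fin k) ℓ} (P? : Decidable P) →
  ∣ setOf P? ∣ ≡ length (filter P? (allFin k))
∣setOf∣≡length-filter P? = ∣tabulate∣≡length-filter P? id

-- Matroids

+-surplus< : ∀ {a b t g} → t + g ≡ a + b → b < t → g < a
+-surplus< {a} {b} {t} {g} eq b<t = +-cancelʳ-≤ b (suc g) a (begin
  suc g + b                  ≡⟨ sym (+-suc g b) ⟩
  g + suc b                  ≤⟨ +-monoʳ-≤ g b<t ⟩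
  g + t                      ≡⟨ +-comm g t ⟩
  t + g                      ≡⟨ eq ⟩
  a + b                      ∎)
  where open ≤-Reasoning

module MatroidProperties {k} (M : Matroid k) where

  ρ : Subset k → ℕ
  ρ = rank M

  ρ-≤ : ∀ X → ρ X ≤ ∣ X ∣
  ρ-≤ = rank-≤ M

  ρ⊤≤k : ρ ⊤ ≤ k
  ρ⊤≤k = ≤-trans (ρ-≤ ⊤) (≤-reflexive (∣⊤∣≡n k))

  ρ-mono : ∀ {X Y} → X ⊆ Y → ρ X ≤ ρ Y
  ρ-mono = rank-mono M _ _

  ρ-submodular-⊆ : ∀ {A B X Y} → A ⊆ X ∪ Y → B ⊆ X ∩ Y → ρ A + ρ B ≤ ρ X + ρ Y
  ρ-submodular-⊆ {X = X} {Y} A⊆X∪Y B⊆X∩Y =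
    ≤-trans (+-mono-≤ (ρ-mono A⊆X∪Y) (ρ-mono B⊆X∩Y)) (rank-sub M X Y)

  ρ-∪-≤ : ∀ X Y → ρ (X ∪ Y) ≤ ρ X + ρ Y
  ρ-∪-≤ X Y = ≤-trans (m≤m+n _ _) (rank-sub M X Y)

  ρ-≤-suc-ρ-remove : ∀ X y → ρ X ≤ suc (ρ (X - y))
  ρ-≤-suc-ρ-remove X y = begin
    ρ X                      ≤⟨ ρ-mono X⊆X-y∪y ⟩
    ρ ((X - y) ∪ ⁅ y ⁆)      ≤⟨ ρ-∪-≤ (X - y) ⁅ y ⁆ ⟩
    ρ (X - y) + ρ ⁅ y ⁆      ≤⟨ +-monoʳ-≤ (ρ (X - y)) (≤-trans (ρ-≤ ⁅ y ⁆) (≤-reflexive (∣⁅x⁆∣≡1 y))) ⟩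
    ρ (X - y) + 1            ≡⟨ +-comm (ρ (X - y)) 1 ⟩
    suc (ρ (X - y))          ∎
    where
    open ≤-Reasoning
    X⊆X-y∪y : X ⊆ (X - y) ∪ ⁅ y ⁆
    X⊆X-y∪y {x} x∈X with x ≟ y
    ... | yes refl = q⊆p∪q (X - y) ⁅ y ⁆ (x∈⁅x⁆ y)
    ... | no x≢y = p⊆p∪q ⁅ y ⁆ (x∈p∧x≢y⇒x∈p-y x∈X x≢y)

  coloop-restrict : ∀ {X Y y} → y ∈ Y → Y ⊆ X → ρ (X - y) < ρ X → ρ (Y - y) < ρ Y
  coloop-restrict {X} {Y} {y} y∈Y Y⊆X coloop = +-cancelˡ-< (ρ X) _ _ (begin-strict
    ρ X + ρ (Y - y)          ≤⟨ ρ-submodular-⊆ X⊆Y∪X-y Y-y⊆Y∩X-y ⟩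
    ρ Y + ρ (X - y)          <⟨ +-monoʳ-< (ρ Y) coloop ⟩
    ρ Y + ρ X                ≡⟨ +-comm (ρ Y) (ρ X) ⟩
    ρ X + ρ Y                ∎)
    where
    open ≤-Reasoning
    X⊆Y∪X-y : X ⊆ Y ∪ (X - y)
    X⊆Y∪X-y {x} x∈X with x ≟ y
    ... | yes refl = p⊆p∪q (X - y) y∈Y
    ... | no x≢y = q⊆p∪q Y (X - y) (x∈p∧x≢y⇒x∈p-y x∈X x≢y)
    Y-y⊆Y∩X-y : Y - y ⊆ Y ∩ (X - y)
    Y-y⊆Y∩X-y {x} x∈Y-y = x∈p∩q⁺ (x∈Y , x∈p∧x≢y⇒x∈p-y (Y⊆X x∈Y) (x∈p-y⇒x≢y Y x∈Y-y))
      where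
      x∈Y : x ∈ Y
      x∈Y = p─q⊆p Y ⁅ y ⁆ x∈Y-y

  Spans : Subset k → Fin k → Set
  Spans X y = ρ (X ∪ ⁅ y ⁆) ≤ ρ X

  ∈⇒Spans : ∀ {X y} → y ∈ X → Spans X y
  ∈⇒Spans {X} {y} y∈X = ρ-mono λ {x} x∈X∪y →
    [ id , (λ x∈y → subst (_∈ X) (sym (x∈⁅y⁆⇒x≡y y x∈y)) y∈X) ]′ (x∈p∪q⁻ X ⁅ y ⁆ x∈X∪y)

  Spans-mono : ∀ {X Y y} → X ⊆ Y → Spans X y → Spans Y y
  Spans-mono {X} {Y} {y} X⊆Y X-spans = +-cancelʳ-≤ (ρ X) _ _ (begin
    ρ (Y ∪ ⁅ y ⁆) + ρ X      ≤⟨ ρ-submodular-⊆ Y∪y⊆ X⊆ ⟩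
    ρ (X ∪ ⁅ y ⁆) + ρ Y      ≤⟨ +-monoˡ-≤ (ρ Y) X-spans ⟩
    ρ X + ρ Y                ≡⟨ +-comm (ρ X) (ρ Y) ⟩
    ρ Y + ρ X                ∎)
    where
    open ≤-Reasoning
    Y∪y⊆ : Y ∪ ⁅ y ⁆ ⊆ (X ∪ ⁅ y ⁆) ∪ Y
    Y∪y⊆ x∈Y∪y =
      [ q⊆p∪q (X ∪ ⁅ y ⁆) Y , p⊆p∪q Y ∘ q⊆p∪q X ⁅ y ⁆ ]′ (x∈p∪q⁻ Y ⁅ y ⁆ x∈Y∪y)
    X⊆ : X ⊆ (X ∪ ⁅ y ⁆) ∩ Y
    X⊆ x∈X = x∈p∩q⁺ (p⊆p∪q ⁅ y ⁆ x∈X , X⊆Y x∈X)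

  ρ-∪-spanned : ∀ X Y → (∀ {y} → y ∈ Y → Spans X y) → ρ (X ∪ Y) ≤ ρ X
  ρ-∪-spanned X = deletion-induction (λ Y → (∀ {y} → y ∈ Y → Spans X y) → ρ (X ∪ Y) ≤ ρ X) step
    where
    step : ∀ Y → (∀ {y} → y ∈ Y → (∀ {z} → z ∈ Y - y → Spans X z) → ρ (X ∪ (Y - y)) ≤ ρ X) →
           (∀ {y} → y ∈ Y → Spans X y) → ρ (X ∪ Y) ≤ ρ X
    step Y ih spanned with nonempty? Y
    ... | no empty = ρ-mono λ x∈X∪Y → [ id , (λ x∈Y → contradiction (_ , x∈Y) empty) ]′ (x∈p∪q⁻ X Y x∈X∪Y)
    ... | yes (y , y∈Y) = begin
      ρ (X ∪ Y)                  ≤⟨ ρ-mono X∪Y⊆ ⟩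
      ρ ((X ∪ (Y - y)) ∪ ⁅ y ⁆)  ≤⟨ Spans-mono (p⊆p∪q (Y - y)) (spanned y∈Y) ⟩
      ρ (X ∪ (Y - y))            ≤⟨ ih y∈Y (spanned ∘ p─q⊆p Y ⁅ y ⁆) ⟩
      ρ X                        ∎
      where
      open ≤-Reasoning
      X∪Y⊆ : X ∪ Y ⊆ (X ∪ (Y - y)) ∪ ⁅ y ⁆
      X∪Y⊆ {x} x∈X∪Y with x ≟ y | x∈p∪q⁻ X Y x∈X∪Y
      ... | yes refl | _ = q⊆p∪q (X ∪ (Y - y)) ⁅ y ⁆ (x∈⁅x⁆ y)
      ... | no _ | inj₁ x∈X = p⊆p∪q ⁅ y ⁆ (p⊆p∪q (Y - y) x∈X)
      ... | no x≢y | inj₂ x∈Y = p⊆p∪q ⁅ y ⁆ (q⊆p∪q X (Y - y) (x∈p∧x≢y⇒x∈p-y x∈Y x≢y))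

  Spans-trans : ∀ {X Y z} → (∀ {y} → y ∈ Y → Spans X y) → Spans Y z → Spans X z
  Spans-trans {X} {Y} {z} spanned Y-spans = begin
    ρ (X ∪ ⁅ z ⁆)            ≤⟨ ρ-mono X∪z⊆ ⟩
    ρ ((X ∪ Y) ∪ ⁅ z ⁆)      ≤⟨ Spans-mono (q⊆p∪q X Y) Y-spans ⟩
    ρ (X ∪ Y)                ≤⟨ ρ-∪-spanned X Y spanned ⟩
    ρ X                      ∎
    where
    open ≤-Reasoning
    X∪z⊆ : X ∪ ⁅ z ⁆ ⊆ (X ∪ Y) ∪ ⁅ z ⁆
    X∪z⊆ x∈ = [ p⊆p∪q ⁅ z ⁆ ∘ p⊆p∪q Y , q⊆p∪q (X ∪ Y) ⁅ z ⁆ ]′ (x∈p∪q⁻ X ⁅ z ⁆ x∈)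

  Indep : Subset k → Set
  Indep X = ρ X ≡ ∣ X ∣

  Indep-remove : ∀ {X y} → y ∈ X → Indep X → Indep (X - y)
  Indep-remove {X} {y} y∈X indep = ≤-antisym (ρ-≤ (X - y)) (s≤s⁻¹ (begin
    suc ∣ X - y ∣            ≡⟨ x∈p⇒suc∣p-x∣≡∣p∣ y∈X ⟩
    ∣ X ∣                    ≡⟨ sym indep ⟩
    ρ X                      ≤⟨ ρ-≤-suc-ρ-remove X y ⟩
    suc (ρ (X - y))          ∎))
    where open ≤-Reasoning

  coloops⇒Indep : ∀ X → (∀ {y} → y ∈ X → ρ (X - y) < ρ X) → Indep X
  coloops⇒Indep = deletion-induction (λ X → (∀ {y} → y ∈ X → ρ (X - y) < ρ X) → Indep X) step
    where
    step : ∀ X → (∀ {y} → y ∈ X → (∀ {z} → z ∈ X - y → ρ (X - y - z) < ρ (X - y)) → Indep (X - y)) →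
           (∀ {y} → y ∈ X → ρ (X - y) < ρ X) → Indep X
    step X ih coloops with nonempty? X
    ... | no empty = trans (n≤0⇒n≡0 (subst (ρ X ≤_) ∣X∣≡0 (ρ-≤ X))) (sym ∣X∣≡0)
      where
      ∣X∣≡0 : ∣ X ∣ ≡ 0
      ∣X∣≡0 = trans (cong ∣_∣ (Empty-unique empty)) (∣⊥∣≡0 k)
    ... | yes (y , y∈X) = ≤-antisym (ρ-≤ X) (begin
      ∣ X ∣                    ≡⟨ sym (x∈p⇒suc∣p-x∣≡∣p∣ y∈X) ⟩
      suc ∣ X - y ∣            ≡⟨ cong suc (sym (ih y∈X coloops-of-X-y)) ⟩
      suc (ρ (X - y))          ≤⟨ coloops y∈X ⟩
      ρ X                      ∎)
      where
      open ≤-Reasoning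
      coloops-of-X-y : ∀ {z} → z ∈ X - y → ρ (X - y - z) < ρ (X - y)
      coloops-of-X-y z∈X-y = coloop-restrict z∈X-y (p─q⊆p X ⁅ y ⁆) (coloops (p─q⊆p X ⁅ y ⁆ z∈X-y))

  record Circuit (C : Subset k) : Set where
    field
      dependent : ρ C < ∣ C ∣
      deletions-independent : ∀ {y} → y ∈ C → Indep (C - y)

  minimal-spanning⇒Circuit : ∀ {S x} → x ∈ S → ρ S ≤ ρ (S - x) →
    (∀ {y} → y ∈ S - x → ρ (S - y - x) < ρ (S - y)) → Circuit S
  minimal-spanning⇒Circuit {S} {x} x∈S x-spanned x-coloop = record
    { dependent = begin-strict
        ρ S                  ≤⟨ x-spanned ⟩
        ρ (S - x)            ≡⟨ S-x-indep ⟩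
        ∣ S - x ∣            <⟨ n<1+n _ ⟩
        suc ∣ S - x ∣        ≡⟨ x∈p⇒suc∣p-x∣≡∣p∣ x∈S ⟩
        ∣ S ∣                ∎
    ; deletions-independent = S-y-indep
    }
    where
    open ≤-Reasoning
    S-x-indep : Indep (S - x)
    S-x-indep = coloops⇒Indep (S - x) λ {z} z∈S-x → begin-strict
      ρ (S - x - z)          ≡⟨ cong ρ (p─x─y≡p─y─x S x z) ⟩
      ρ (S - z - x)          <⟨ x-coloop z∈S-x ⟩
      ρ (S - z)              ≤⟨ ρ-mono (p─q⊆p S ⁅ z ⁆) ⟩
      ρ S                    ≤⟨ x-spanned ⟩
      ρ (S - x)              ∎
    S-y-indep : ∀ {y} → y ∈ S → Indep (S - y)
    S-y-indep {y} y∈S with y ≟ x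
    ... | yes refl = S-x-indep
    ... | no y≢x = ≤-antisym (ρ-≤ (S - y)) (begin
      ∣ S - y ∣              ≡⟨ sym (x∈p⇒suc∣p-x∣≡∣p∣ (x∈p∧x≢y⇒x∈p-y x∈S (y≢x ∘ sym))) ⟩
      suc ∣ S - y - x ∣      ≡⟨ cong (suc ∘ ∣_∣) (p─x─y≡p─y─x S y x) ⟩
      suc ∣ S - x - y ∣      ≡⟨ cong suc (sym (Indep-remove y∈S-x S-x-indep)) ⟩
      suc (ρ (S - x - y))    ≡⟨ cong (suc ∘ ρ) (p─x─y≡p─y─x S x y) ⟩
      suc (ρ (S - y - x))    ≤⟨ x-coloop y∈S-x ⟩
      ρ (S - y)              ∎)
      where
      y∈S-x : y ∈ S - x
      y∈S-x = x∈p∧x≢y⇒x∈p-y y∈S y≢x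

  circuit-through : ∀ {x} S → x ∈ S → ρ S ≤ ρ (S - x) → ∃ λ C → C ⊆ S × x ∈ C × Circuit C
  circuit-through {x} = deletion-induction P step
    where
    P : Subset k → Set
    P S = x ∈ S → ρ S ≤ ρ (S - x) → ∃ λ C → C ⊆ S × x ∈ C × Circuit C
    step : ∀ S → (∀ {y} → y ∈ S → P (S - y)) → P S
    step S ih x∈S x-spanned with Fin.any? (λ y → (y ∈? S - x) ×-dec (ρ (S - y) ≤? ρ (S - y - x)))
    ... | no none = S , ⊆-refl , x∈S , minimal-spanning⇒Circuit x∈S x-spanned
                      (λ {y} y∈S-x → ≰⇒> (λ le → none (y , y∈S-x , le)))
    ... | yes (y , y∈S-x , x-spanned-in-S-y)
      with ih (p─q⊆p S ⁅ x ⁆ y∈S-x) (x∈p∧x≢y⇒x∈p-y x∈S (x∈p-y⇒x≢y S y∈S-x ∘ sym)) x-spanned-in-S-y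
    ...   | C , C⊆S-y , x∈C , circuit = C , ⊆-trans C⊆S-y (p─q⊆p S ⁅ y ⁆) , x∈C , circuit

  low-rank-side⇒¬VerticallyConnected : ∀ {c} A → ρ A < c → ρ (∁ A) < ρ ⊤ → ¬ VerticallyConnected M c
  low-rank-side⇒¬VerticallyConnected {c} A ρA<c ρ∁A<ρ⊤ (c≤ρ⊤ , no-separation) =
    no-separation (suc g) (s≤s z≤n) (≤-<-trans g<ρA ρA<c) A (g<ρA , g<ρ∁A , ≤-reflexive sum+1≡)
    where
    ρ⊤≤ : ρ ⊤ ≤ ρ A + ρ (∁ A)
    ρ⊤≤ = subst (λ X → ρ X ≤ ρ A + ρ (∁ A)) (p∪∁p≡⊤ A) (ρ-∪-≤ A (∁ A))
    g : ℕ
    g = proj₁ (m≤n⇒∃[o]m+o≡n ρ⊤≤)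
    ρ⊤+g≡ : ρ ⊤ + g ≡ ρ A + ρ (∁ A)
    ρ⊤+g≡ = proj₂ (m≤n⇒∃[o]m+o≡n ρ⊤≤)
    g<ρA : g < ρ A
    g<ρA = +-surplus< ρ⊤+g≡ ρ∁A<ρ⊤
    g<ρ∁A : g < ρ (∁ A)
    g<ρ∁A = +-surplus< (trans ρ⊤+g≡ (+-comm (ρ A) (ρ (∁ A)))) (<-≤-trans ρA<c c≤ρ⊤)
    sum+1≡ : ρ A + ρ (∁ A) + 1 ≡ ρ ⊤ + suc g
    sum+1≡ = trans (cong (_+ 1) (sym ρ⊤+g≡)) (trans (+-assoc (ρ ⊤) g 1) (cong (ρ ⊤ +_) (+-comm g 1)))

-- Graphs and embeddings

SameEdge-sym : ∀ {k} {a b : Fin k × Fin k} → SameEdge a b → SameEdge b a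
SameEdge-sym (inj₁ (p , q)) = inj₁ (sym p , sym q)
SameEdge-sym (inj₂ (p , q)) = inj₂ (sym q , sym p)

SameEdge-trans : ∀ {k} {a b c : Fin k × Fin k} → SameEdge a b → SameEdge b c → SameEdge a c
SameEdge-trans (inj₁ (p , q)) (inj₁ (p′ , q′)) = inj₁ (trans p p′ , trans q q′)
SameEdge-trans (inj₁ (p , q)) (inj₂ (p′ , q′)) = inj₂ (trans p p′ , trans q q′)
SameEdge-trans (inj₂ (p , q)) (inj₁ (p′ , q′)) = inj₂ (trans p q′ , trans q p′)
SameEdge-trans (inj₂ (p , q)) (inj₂ (p′ , q′)) = inj₁ (trans p q′ , trans q p′)

SameEdge-map : ∀ {k l} (f : Fin k → Fin l) {a b : Fin k × Fin k} → SameEdge a b →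
  SameEdge (f (proj₁ a) , f (proj₂ a)) (f (proj₁ b) , f (proj₂ b))
SameEdge-map f (inj₁ (p , q)) = inj₁ (cong f p , cong f q)
SameEdge-map f (inj₂ (p , q)) = inj₂ (cong f p , cong f q)

SameEdge-within : ∀ {k} {W : Subset k} {a b : Fin k × Fin k} → SameEdge a b →
  proj₁ a ∈ W → proj₂ a ∈ W → proj₁ b ∈ W × proj₂ b ∈ W
SameEdge-within (inj₁ (refl , refl)) a₁∈W a₂∈W = a₁∈W , a₂∈W
SameEdge-within (inj₂ (refl , refl)) a₁∈W a₂∈W = a₂∈W , a₁∈W

SameEdge-diagonal : ∀ {k} {a : Fin k × Fin k} {y} → SameEdge a (y , y) → proj₁ a ≡ proj₂ a
SameEdge-diagonal (inj₁ (a₁≡y , a₂≡y)) = trans a₁≡y (sym a₂≡y)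
SameEdge-diagonal (inj₂ (a₁≡y , a₂≡y)) = trans a₁≡y (sym a₂≡y)

module _ (G : Graph) where

  Incident : Fin (n G) → Fin (m G) → Set
  Incident v e = proj₁ (ends G e) ≡ v ⊎ proj₂ (ends G e) ≡ v

  incident? : ∀ v → Decidable (Incident v)
  incident? v e = (proj₁ (ends G e) ≟ v) ⊎-dec (proj₂ (ends G e) ≟ v)

  star : Fin (n G) → Subset (m G)
  star v = setOf (incident? v)

  ∣star∣≡degree : ∀ v → ∣ star v ∣ ≡ degree G v
  ∣star∣≡degree v = ∣setOf∣≡length-filter (incident? v)

  degree>0 : ∀ v → 0 < degree G v
  degree>0 v with noIsolated G v
  ... | e , incident =
    subst (0 <_) (trans (x∈p⇒suc∣p-x∣≡∣p∣ (∈-setOf⁺ (incident? v) incident)) (∣star∣≡degree v)) z<s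

  minimum-degree : Fin (n G) → ∃ λ δ → MinDegree G (suc δ)
  minimum-degree v = pred (degree G u) , subst (MinDegree G) degree≡suc-pred (u-min , u , refl)
    where
    u : Fin (n G)
    u = argmin (degree G) v (allFin (n G))
    u-min : ∀ w → degree G u ≤ degree G w
    u-min w = All.lookup (f[argmin]≤f[xs] v (allFin (n G))) (∈-allFin w)
    degree≡suc-pred : degree G u ≡ suc (pred (degree G u))
    degree≡suc-pred = sym (suc-pred (degree G u) {{>-nonZero (degree>0 u)}})

  opposite : Fin (n G) → Fin (m G) → Fin (n G)
  opposite v e with proj₁ (ends G e) ≟ v
  ... | yes _ = proj₂ (ends G e)
  ... | no _ = proj₁ (ends G e)

  ends≈opposite : ∀ {v e} → Incident v e → SameEdge (ends G e) (v , opposite v e)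
  ends≈opposite {v} {e} incident with proj₁ (ends G e) ≟ v | incident
  ... | yes e₁≡v | _ = inj₁ (e₁≡v , refl)
  ... | no e₁≢v | inj₁ e₁≡v = contradiction e₁≡v e₁≢v
  ... | no _ | inj₂ e₂≡v = inj₂ (refl , e₂≡v)

  opposite≢ : ∀ {v e} → Incident v e → opposite v e ≢ v
  opposite≢ {v} {e} incident eq = loopless G e
    (SameEdge-diagonal (subst (λ w → SameEdge (ends G e) (v , w)) eq (ends≈opposite incident)))

  opposite-injective : ∀ {v e f} → Incident v e → Incident v f → opposite v e ≡ opposite v f → e ≡ f
  opposite-injective inc-e inc-f eq = simple G _ _ (SameEdge-trans (ends≈opposite inc-e)
    (SameEdge-trans (inj₁ (refl , eq)) (SameEdge-sym (ends≈opposite inc-f))))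

  degree<n : ∀ v → degree G v < n G
  degree<n v = begin-strict
    degree G v                 ≡⟨ sym (∣star∣≡degree v) ⟩
    ∣ star v ∣                 ≤⟨ injectiveOn⇒∣p∣≤∣q∣ (opposite v)
                                    (λ e∈ → x∉p⇒x∈∁p (opposite≢ (incident e∈) ∘ x∈⁅y⁆⇒x≡y v))
                                    (λ e∈ f∈ → opposite-injective (incident e∈) (incident f∈)) ⟩
    ∣ ∁ ⁅ v ⁆ ∣                ≡⟨ trans (∣∁p∣≡n∸∣p∣ ⁅ v ⁆) (cong (n G ∸_) (∣⁅x⁆∣≡1 v)) ⟩
    n G ∸ 1                    <⟨ ∸-monoʳ-< z<s (≤-trans (s≤s z≤n) (Fin.toℕ<n v)) ⟩
    n G                        ∎
    where
    open ≤-Reasoning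
    incident : ∀ {e} → e ∈ star v → Incident v e
    incident = ∈-setOf⁻ (incident? v)

module _ (G : Graph) (W : Subset (n G)) where

  Within : Fin (m G) → Set
  Within e = proj₁ (ends G e) ∈ W × proj₂ (ends G e) ∈ W

  within? : Decidable Within
  within? e = (proj₁ (ends G e) ∈? W) ×-dec (proj₂ (ends G e) ∈? W)

  inducedEdges : Subset (m G)
  inducedEdges = setOf within?

inducedEdges-mono : ∀ G {W W′} → W ⊆ W′ → inducedEdges G W ⊆ inducedEdges G W′
inducedEdges-mono G {W} {W′} W⊆W′ e∈ =
  let a∈W , b∈W = ∈-setOf⁻ (within? G W) e∈ in ∈-setOf⁺ (within? G W′) (W⊆W′ a∈W , W⊆W′ b∈W)

module _ {k l} (f : Fin k → Fin l) (X : Subset k) where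

  image? : Decidable (λ y → ∃ λ x → x ∈ X × f x ≡ y)
  image? y = Fin.any? (λ x → (x ∈? X) ×-dec (f x ≟ y))

  image : Subset l
  image = setOf image?

  image-isImage : IsImage f X image
  image-isImage y = ∈-setOf⁻ image? , λ x x∈X → ∈-setOf⁺ image? (x , x∈X , refl)

enum-isImage : ∀ {k} {p : Subset k} {X : Subset ∣ p ∣} {Y : Subset k} → Y ⊆ p →
  (∀ {i} → i ∈ X → enum p i ∈ Y) → (∀ {i} → enum p i ∈ Y → i ∈ X) → IsImage (enum p) X Y
enum-isImage Y⊆p X→Y Y→X y =
  (λ y∈Y → index (Y⊆p y∈Y) , Y→X (subst (_∈ _) (sym (enum-index (Y⊆p y∈Y))) y∈Y) , enum-index (Y⊆p y∈Y)) ,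
  (λ i i∈X → X→Y i∈X)

module EdgeInducedSubgraph (G : Graph) (C : Subset (m G)) where

  Covered : Fin (n G) → Set
  Covered w = ∃ λ e → e ∈ C × Incident G w e

  covered? : Decidable Covered
  covered? w = Fin.any? (λ e → (e ∈? C) ×-dec incident? G w e)

  covered : Subset (n G)
  covered = setOf covered?

  covered⁺ : ∀ {w e} → e ∈ C → Incident G w e → w ∈ covered
  covered⁺ {e = e} e∈C incident = ∈-setOf⁺ covered? (e , e∈C , incident)

  vertex : Fin ∣ covered ∣ → Fin (n G)
  vertex = enum covered

  edge : Fin ∣ C ∣ → Fin (m G)
  edge = enum C

  end₁∈ : ∀ i → proj₁ (ends G (edge i)) ∈ covered
  end₁∈ i = covered⁺ (enum-∈ C i) (inj₁ refl)

  end₂∈ : ∀ i → proj₂ (ends G (edge i)) ∈ covered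
  end₂∈ i = covered⁺ (enum-∈ C i) (inj₂ refl)

  endsH : Fin ∣ C ∣ → Fin ∣ covered ∣ × Fin ∣ covered ∣
  endsH i = index (end₁∈ i) , index (end₂∈ i)

  edge-endsH : ∀ i → SameEdge (vertex (proj₁ (endsH i)) , vertex (proj₂ (endsH i))) (ends G (edge i))
  edge-endsH i = inj₁ (enum-index (end₁∈ i) , enum-index (end₂∈ i))

  H : Graph
  H = record
    { n = ∣ covered ∣
    ; m = ∣ C ∣
    ; ends = endsH
    ; loopless = λ i eq → loopless G (edge i)
        (trans (sym (enum-index (end₁∈ i))) (trans (cong vertex eq) (enum-index (end₂∈ i))))
    ; simple = λ i j same → enum-injective C (simple G (edge i) (edge j)
        (SameEdge-trans (SameEdge-sym (edge-endsH i))
          (SameEdge-trans (SameEdge-map vertex same) (edge-endsH j))))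
    ; noIsolated = noIsolatedH
    }
    where
    noIsolatedH : ∀ j → ∃ λ i → proj₁ (endsH i) ≡ j ⊎ proj₂ (endsH i) ≡ j
    noIsolatedH j with ∈-setOf⁻ covered? (enum-∈ covered j)
    ... | e , e∈C , incident = index e∈C , [ inj₁ ∘ at-end₁ , inj₂ ∘ at-end₂ ]′ incident
      where
      at-end₁ : proj₁ (ends G e) ≡ vertex j → proj₁ (endsH (index e∈C)) ≡ j
      at-end₁ eq = index-unique (end₁∈ (index e∈C))
        (trans (sym eq) (cong (proj₁ ∘ ends G) (sym (enum-index e∈C))))
      at-end₂ : proj₂ (ends G e) ≡ vertex j → proj₂ (endsH (index e∈C)) ≡ j
      at-end₂ eq = index-unique (end₂∈ (index e∈C))
        (trans (sym eq) (cong (proj₂ ∘ ends G) (sym (enum-index e∈C))))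

  embedding : Embedding H G
  embedding = record { φ = vertex ; φ-inj = enum-injective covered ; ψ = edge ; ψ-ends = edge-endsH }

  Incident-edge : ∀ {j i} → Incident H j i → Incident G (vertex j) (edge i)
  Incident-edge {j} {i} (inj₁ eq) = inj₁ (trans (sym (enum-index (end₁∈ i))) (cong vertex eq))
  Incident-edge {j} {i} (inj₂ eq) = inj₂ (trans (sym (enum-index (end₂∈ i))) (cong vertex eq))

  degreeH≤ : ∀ j → degree H j ≤ ∣ C ∩ star G (vertex j) ∣
  degreeH≤ j = begin
    degree H j                 ≡⟨ sym (∣star∣≡degree H j) ⟩
    ∣ star H j ∣               ≤⟨ injectiveOn⇒∣p∣≤∣q∣ edge edge∈ (λ _ _ → enum-injective C) ⟩
    ∣ C ∩ star G (vertex j) ∣  ∎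
    where
    open ≤-Reasoning
    edge∈ : ∀ {i} → i ∈ star H j → edge i ∈ C ∩ star G (vertex j)
    edge∈ {i} i∈star =
      x∈p∩q⁺ (enum-∈ C i , ∈-setOf⁺ (incident? G _) (Incident-edge (∈-setOf⁻ (incident? H j) i∈star)))

  edge-image-⊤ : IsImage edge ⊤ C
  edge-image-⊤ = enum-isImage ⊆-refl (λ {i} _ → enum-∈ C i) (λ _ → ∈⊤)

  edge-image-minus : ∀ i → IsImage edge (minusEdge i) (C - edge i)
  edge-image-minus i = enum-isImage (p─q⊆p C ⁅ edge i ⁆)
    (λ {j} j∈∁i → x∈p∧x≢y⇒x∈p-y (enum-∈ C j)
       (λ eq → x∈∁p⇒x∉p j∈∁i (subst (_∈ ⁅ i ⁆) (sym (enum-injective C eq)) (x∈⁅x⁆ i))))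
    (λ {j} j∈C-i → x∉p⇒x∈∁p (x∈p-y⇒x≢y C j∈C-i ∘ cong edge ∘ x∈⁅y⁆⇒x≡y i))

  Circuit⇒IsCircuit : (𝓜 : GraphMatroidFamily) → MatroidProperties.Circuit (M 𝓜 G) C → IsCircuit 𝓜 H
  Circuit⇒IsCircuit 𝓜 circuit = dependent , deletions-independent
    where
    open MatroidProperties (M 𝓜 G)
    open Circuit circuit using () renaming (dependent to ρC<∣C∣; deletions-independent to C-y-indep)
    transfer : ∀ {X Y} → IsImage edge X Y → rank (M 𝓜 H) X ≡ ρ Y
    transfer = embed-rank 𝓜 H G embedding _ _
    dependent : ¬ Independent 𝓜 H
    dependent indep = <-irrefl (trans (sym (transfer edge-image-⊤)) indep) ρC<∣C∣
    deletions-independent : ∀ i → rank (M 𝓜 H) (minusEdge i) ≡ ∣ minusEdge {∣ C ∣} i ∣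
    deletions-independent i = begin
      rank (M 𝓜 H) (minusEdge i)   ≡⟨ transfer (edge-image-minus i) ⟩
      ρ (C - edge i)               ≡⟨ C-y-indep (enum-∈ C i) ⟩
      ∣ C - edge i ∣               ≡⟨ suc-injective (trans (x∈p⇒suc∣p-x∣≡∣p∣ (enum-∈ C i)) (sym (suc∣∁⁅x⁆∣≡k i))) ⟩
      ∣ minusEdge {∣ C ∣} i ∣      ∎
      where open ≡-Reasoning

complete-embedding : ∀ {H G} → IsComplete G → (f : Fin (n H) → Fin (n G)) →
  (∀ {a b} → f a ≡ f b → a ≡ b) → Embedding H G
complete-embedding {H} {G} complete f f-inj = record
  { φ = f
  ; φ-inj = f-inj
  ; ψ = λ e → proj₁ (adjacent e)
  ; ψ-ends = λ e → SameEdge-sym (proj₂ (adjacent e))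
  }
  where
  adjacent : ∀ e → Adjacent G (f (proj₁ (ends H e))) (f (proj₂ (ends H e)))
  adjacent e = complete _ _ (loopless H e ∘ f-inj)

module _ (𝓜 : GraphMatroidFamily) where

  IsCircuit⇒r≤rank-minusEdge : ∀ {H} → IsCircuit 𝓜 H → ∀ e → r 𝓜 H ≤ rank (M 𝓜 H) (minusEdge e)
  IsCircuit⇒r≤rank-minusEdge {H} (dependent , deletions-independent) e = s≤s⁻¹ (begin
    suc (r 𝓜 H)                      ≤⟨ ≤∧≢⇒< (MatroidProperties.ρ⊤≤k (M 𝓜 H)) dependent ⟩
    m H                              ≡⟨ sym (suc∣∁⁅x⁆∣≡k e) ⟩
    suc ∣ minusEdge {m H} e ∣        ≡⟨ cong suc (sym (deletions-independent e)) ⟩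
    suc (rank (M 𝓜 H) (minusEdge e)) ∎)
    where open ≤-Reasoning

  embedded-circuit-spans : ∀ {H G} (f : Embedding H G) → IsCircuit 𝓜 H → ∀ e →
    MatroidProperties.Spans (M 𝓜 G) (image (ψ f) (minusEdge e)) (ψ f e)
  embedded-circuit-spans {H} {G} f circuit e = begin
    ρ (Rest ∪ ⁅ ψ f e ⁆)           ≡⟨ sym (embed-rank 𝓜 H G f ⊤ _ image-⊤) ⟩
    r 𝓜 H                          ≤⟨ IsCircuit⇒r≤rank-minusEdge circuit e ⟩
    rank (M 𝓜 H) (minusEdge e)     ≡⟨ embed-rank 𝓜 H G f _ _ (image-isImage (ψ f) (minusEdge e)) ⟩
    ρ Rest                         ∎
    where
    open ≤-Reasoning
    open MatroidProperties (M 𝓜 G)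
    Rest : Subset (m G)
    Rest = image (ψ f) (minusEdge e)
    image-⊤ : IsImage (ψ f) ⊤ (Rest ∪ ⁅ ψ f e ⁆)
    image-⊤ y = preimage , λ x _ → image-∈ x
      where
      preimage : y ∈ Rest ∪ ⁅ ψ f e ⁆ → ∃ λ x → x ∈ ⊤ × ψ f x ≡ y
      preimage y∈ with x∈p∪q⁻ Rest _ y∈
      ... | inj₁ y∈Rest =
        let x , _ , ψx≡y = proj₁ (image-isImage (ψ f) (minusEdge e) y) y∈Rest in x , ∈⊤ , ψx≡y
      ... | inj₂ y∈ψe = e , ∈⊤ , sym (x∈⁅y⁆⇒x≡y _ y∈ψe)
      image-∈ : ∀ x → ψ f x ∈ Rest ∪ ⁅ ψ f e ⁆
      image-∈ x with x ≟ e
      ... | yes refl = q⊆p∪q Rest _ (x∈⁅x⁆ (ψ f e))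
      ... | no x≢e =
        p⊆p∪q ⁅ ψ f e ⁆ (proj₂ (image-isImage (ψ f) (minusEdge e) y) x (x∉p⇒x∈∁p (x≢e ∘ x∈⁅y⁆⇒x≡y e)))

-- Circuits with a leaf bound the rank of complete graphs

transpose-closed : ∀ {k ℓ} (P : Pred (Fin k) ℓ) {i j l} → P i → P j → P l → P (transpose i j l)
transpose-closed P {i} {j} {l} Pi Pj Pl with l ≟ i
... | yes _ = Pj
... | no _ with l ≟ j
...   | yes _ = Pi
...   | no _ = Pl

transpose-ʳ : ∀ {k} (i j : Fin k) → transpose i j j ≡ i
transpose-ʳ i j with j ≟ i
... | yes j≡i = j≡i
... | no _ with j ≟ j
...   | yes _ = refl
...   | no j≢j = contradiction refl j≢j

transpose-fixes : ∀ {k} {i j l : Fin k} → l ≢ i → l ≢ j → transpose i j l ≡ l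
transpose-fixes {i = i} {j} {l} l≢i l≢j with l ≟ i
... | yes l≡i = contradiction l≡i l≢i
... | no _ with l ≟ j
...   | yes l≡j = contradiction l≡j l≢j
...   | no _ = refl

transpose-injective : ∀ {k} (i j : Fin k) {l l′} → transpose i j l ≡ transpose i j l′ → l ≡ l′
transpose-injective i j {l} {l′} eq =
  trans (sym (transpose-inverse j i)) (trans (cong (transpose j i) eq) (transpose-inverse j i))

module Placement {c N : ℕ} {u w : Fin c} (u≢w : u ≢ w) {y z : Fin N} (y≢z : y ≢ z) (c≤z : c ≤ toℕ z) where

  Target : Fin N → Set
  Target a = toℕ a < c ⊎ a ≡ y

  z∉Target : ¬ Target z
  z∉Target (inj₁ z<c) = <⇒≱ z<c c≤z
  z∉Target (inj₂ z≡y) = y≢z (sym z≡y)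

  c≤N : c ≤ N
  c≤N = ≤-trans c≤z (<⇒≤ (Fin.toℕ<n z))

  ι : Fin c → Fin N
  ι x = inject≤ x c≤N

  ι-target : ∀ x → Target (ι x)
  ι-target x = inj₁ (subst (_< c) (sym (Fin.toℕ-inject≤ x c≤N)) (Fin.toℕ<n x))

  pre : Fin c → Fin N
  pre x = transpose y (ι w) (ι x)

  pre-injective : ∀ {x x′} → pre x ≡ pre x′ → x ≡ x′
  pre-injective = Fin.inject≤-injective c≤N c≤N _ _ ∘ transpose-injective y (ι w)

  pre-target : ∀ x → Target (pre x)
  pre-target x = transpose-closed Target (inj₂ refl) (ι-target w) (ι-target x)

  place : Fin c → Fin N
  place x = transpose z (pre u) (pre x)

  place-injective : ∀ {x x′} → place x ≡ place x′ → x ≡ x′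
  place-injective = pre-injective ∘ transpose-injective z (pre u)

  place-u : place u ≡ z
  place-u = transpose-ʳ z (pre u)

  place-fixes : ∀ {x} → x ≢ u → place x ≡ pre x
  place-fixes {x} x≢u =
    transpose-fixes (z∉Target ∘ λ eq → subst Target eq (pre-target x)) (x≢u ∘ pre-injective)

  place-w : place w ≡ y
  place-w = trans (place-fixes (u≢w ∘ sym)) (transpose-ʳ y (ι w))

  place-target : ∀ {x} → x ≢ u → Target (place x)
  place-target {x} x≢u = subst Target (sym (place-fixes x≢u)) (pre-target x)

module LeafCircuit (𝓜 : GraphMatroidFamily) {C₀ : Graph} (circuit : IsCircuit 𝓜 C₀)
                   {u : Fin (n C₀)} (degree-u≡1 : degree C₀ u ≡ 1)
                   {K : Graph} (complete : IsComplete K) where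

  open MatroidProperties (M 𝓜 K)

  c : ℕ
  c = n C₀

  ∣star-u∣≡1 : ∣ star C₀ u ∣ ≡ 1
  ∣star-u∣≡1 = trans (∣star∣≡degree C₀ u) degree-u≡1

  leaf-edge : Nonempty (star C₀ u)
  leaf-edge = ∣p∣>0⇒Nonempty (subst (0 <_) (sym ∣star-u∣≡1) z<s)

  e : Fin (m C₀)
  e = proj₁ leaf-edge

  u-e : Incident C₀ u e
  u-e = ∈-setOf⁻ (incident? C₀ u) (proj₂ leaf-edge)

  only-e : ∀ {g} → Incident C₀ u g → g ≡ e
  only-e u-g = ∣p∣≡1⇒y≡x ∣star-u∣≡1 (proj₂ leaf-edge) (∈-setOf⁺ (incident? C₀ u) u-g)

  w : Fin (n C₀)
  w = opposite C₀ u e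

  u≢w : u ≢ w
  u≢w = opposite≢ C₀ u-e ∘ sym

  low : Subset (n K)
  low = setOf (λ a → toℕ a <? c)

  low-intro : ∀ {a} → toℕ a < c → a ∈ low
  low-intro = ∈-setOf⁺ (λ a → toℕ a <? c)

  E[_] : Subset (n K) → Subset (m K)
  E[_] = inducedEdges K

  E-ends : ∀ {W f} → f ∈ E[ W ] → Within K W f
  E-ends {W} = ∈-setOf⁻ (within? K W)

  E-intro : ∀ {W f} → Within K W f → f ∈ E[ W ]
  E-intro {W} = ∈-setOf⁺ (within? K W)

  -- Embed C₀ with u ↦ z, w ↦ y and all other vertices into low ∪ ⁅ y ⁆; the leaf edge
  -- lands on f, and the other edges of C₀, which avoid u, span it.
  spanned-by-low∪y : ∀ {f y z} → SameEdge (ends K f) (y , z) → z ∉ low → Spans E[ low ∪ ⁅ y ⁆ ] f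
  spanned-by-low∪y {f} {y} {z} f≈yz z∉low =
    subst (Spans E[ low ∪ ⁅ y ⁆ ]) ψe≡f (Spans-mono image⊆E (embedded-circuit-spans 𝓜 embedding circuit e))
    where
    y≢z : y ≢ z
    y≢z refl = loopless K f (SameEdge-diagonal f≈yz)
    open Placement u≢w y≢z (≮⇒≥ (z∉low ∘ low-intro))
    embedding : Embedding C₀ K
    embedding = complete-embedding complete place place-injective
    ψe≡f : ψ embedding e ≡ f
    ψe≡f = simple K _ _ (SameEdge-trans (SameEdge-sym (ψ-ends embedding e))
             (SameEdge-trans (SameEdge-map place (ends≈opposite C₀ u-e))
               (SameEdge-trans (inj₂ (place-u , place-w)) (SameEdge-sym f≈yz))))
    target∈ : ∀ {a} → Target a → a ∈ low ∪ ⁅ y ⁆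
    target∈ (inj₁ a<c) = p⊆p∪q ⁅ y ⁆ (low-intro a<c)
    target∈ (inj₂ refl) = q⊆p∪q low ⁅ y ⁆ (x∈⁅x⁆ y)
    image⊆E : image (ψ embedding) (minusEdge e) ⊆ E[ low ∪ ⁅ y ⁆ ]
    image⊆E g′∈ with ∈-setOf⁻ (image? (ψ embedding) (minusEdge e)) g′∈
    ... | g , g∈E-e , refl = E-intro (SameEdge-within (ψ-ends embedding g)
          (target∈ (place-target (g≢e ∘ only-e ∘ inj₁))) (target∈ (place-target (g≢e ∘ only-e ∘ inj₂))))
      where
      g≢e : g ≢ e
      g≢e g≡e = x∈∁p⇒x∉p g∈E-e (subst (_∈ ⁅ e ⁆) (sym g≡e) (x∈⁅x⁆ e))

  low∪⊆low : ∀ {a} → a ∈ low → low ∪ ⁅ a ⁆ ⊆ low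
  low∪⊆low a∈low x∈ = [ id , (λ x∈a → subst (_∈ low) (sym (x∈⁅y⁆⇒x≡y _ x∈a)) a∈low) ]′ (x∈p∪q⁻ low _ x∈)

  spanned-with-low-end : ∀ f → proj₁ (ends K f) ∈ low ⊎ proj₂ (ends K f) ∈ low → Spans E[ low ] f
  spanned-with-low-end f end∈low with proj₁ (ends K f) ∈? low | proj₂ (ends K f) ∈? low
  ... | yes a∈low | yes b∈low = ∈⇒Spans (E-intro (a∈low , b∈low))
  ... | yes a∈low | no b∉low =
    Spans-mono (inducedEdges-mono K (low∪⊆low a∈low)) (spanned-by-low∪y (inj₁ (refl , refl)) b∉low)
  ... | no a∉low | yes b∈low =
    Spans-mono (inducedEdges-mono K (low∪⊆low b∈low)) (spanned-by-low∪y (inj₂ (refl , refl)) a∉low)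
  ... | no a∉low | no b∉low = contradiction end∈low [ a∉low , b∉low ]′

  low-end : ∀ {a g} → g ∈ E[ low ∪ ⁅ a ⁆ ] → proj₁ (ends K g) ∈ low ⊎ proj₂ (ends K g) ∈ low
  low-end {a} {g} g∈ with E-ends g∈
  ... | g₁∈ , g₂∈ with x∈p∪q⁻ low ⁅ a ⁆ g₁∈ | x∈p∪q⁻ low ⁅ a ⁆ g₂∈
  ...   | inj₁ g₁∈low | _ = inj₁ g₁∈low
  ...   | inj₂ _ | inj₁ g₂∈low = inj₂ g₂∈low
  ...   | inj₂ g₁∈a | inj₂ g₂∈a =
    contradiction (trans (x∈⁅y⁆⇒x≡y a g₁∈a) (sym (x∈⁅y⁆⇒x≡y a g₂∈a))) (loopless K g)

  spanned-by-low : ∀ f → Spans E[ low ] f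
  spanned-by-low f with proj₁ (ends K f) ∈? low | proj₂ (ends K f) ∈? low
  ... | yes a∈low | _ = spanned-with-low-end f (inj₁ a∈low)
  ... | no _ | yes b∈low = spanned-with-low-end f (inj₂ b∈low)
  ... | no _ | no b∉low = Spans-trans (λ {g} g∈ → spanned-with-low-end g (low-end g∈))
                            (spanned-by-low∪y (inj₁ (refl , refl)) b∉low)

  ∣E[low]∣≤c*c : ∣ E[ low ] ∣ ≤ c * c
  ∣E[low]∣≤c*c = injective⇒≤ {f = code} code-injective
    where
    ends< : ∀ i → toℕ (proj₁ (ends K (enum E[ low ] i))) < c × toℕ (proj₂ (ends K (enum E[ low ] i))) < c
    ends< i = let a∈ , b∈ = E-ends (enum-∈ E[ low ] i) in
      ∈-setOf⁻ (λ a → toℕ a <? c) a∈ , ∈-setOf⁻ (λ a → toℕ a <? c) b∈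
    code : Fin ∣ E[ low ] ∣ → Fin (c * c)
    code i = combine (fromℕ< (proj₁ (ends< i))) (fromℕ< (proj₂ (ends< i)))
    code-injective : ∀ {i j} → code i ≡ code j → i ≡ j
    code-injective {i} {j} eq with Fin.combine-injective _ _ _ _ eq
    ... | eq₁ , eq₂ = enum-injective E[ low ] (simple K _ _ (inj₁
          (Fin.toℕ-injective (Fin.fromℕ<-injective _ _ (proj₁ (ends< i)) (proj₁ (ends< j)) eq₁) ,
           Fin.toℕ-injective (Fin.fromℕ<-injective _ _ (proj₂ (ends< i)) (proj₂ (ends< j)) eq₂))))

  r≤c*c : r 𝓜 K ≤ c * c
  r≤c*c = begin
    ρ ⊤                        ≤⟨ ρ-mono (q⊆p∪q E[ low ] ⊤) ⟩
    ρ (E[ low ] ∪ ⊤)           ≤⟨ ρ-∪-spanned E[ low ] ⊤ (λ {f} _ → spanned-by-low f) ⟩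
    ρ E[ low ]                 ≤⟨ ρ-≤ E[ low ] ⟩
    ∣ E[ low ] ∣               ≤⟨ ∣E[low]∣≤c*c ⟩
    c * c                      ∎
    where open ≤-Reasoning

dimensionality-positive : ∀ 𝓜 → Unbounded 𝓜 → ∀ {d} →
  (∃ λ C → IsCircuit 𝓜 C × MinDegree C (suc d)) → 0 < d
dimensionality-positive _ _ {suc d} _ = z<s
dimensionality-positive 𝓜 unbounded {zero} (C₀ , circuit , _ , u , degree-u≡1)
  with unbounded (suc (n C₀ * n C₀))
... | K , complete , c*c<r =
  contradiction (≤-trans c*c<r (LeafCircuit.r≤c*c 𝓜 circuit degree-u≡1 complete)) 1+n≰n

-- The degree bound

small-split : ∀ {t d c} → 0 < t → 0 < d → 2 ≤ c → t < c + d ∸ 1 →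
  ∃ λ j → ∃ λ a → j + a ≡ t × j < d × 0 < a × a < c
small-split {suc t} {suc d} {c} _ _ 2≤c t<c+d∸1 with d ≤? t
... | yes d≤t = d , suc (t ∸ d) , trans (+-suc d (t ∸ d)) (cong suc (m+[n∸m]≡n d≤t)) , ≤-refl , z<s ,
                +-cancelʳ-< d (suc (t ∸ d)) c (subst (_< c + d) (cong suc (sym (m∸n+n≡m d≤t))) t<c+d)
  where
  t<c+d : suc t < c + d
  t<c+d = subst (suc t <_) (cong (_∸ 1) (+-suc c d)) t<c+d∸1
... | no d≰t = t , 1 , +-comm t 1 , m<n⇒m<1+n (≰⇒> d≰t) , z<s , 2≤c

module _ (𝓜 : GraphMatroidFamily) {d : ℕ}
         (d-least : ∀ d′ → (∃ λ C → IsCircuit 𝓜 C × MinDegree C (suc d′)) → d ≤ d′) where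

  sparse-at-endpoint⇒coloop : ∀ G {S : Subset (m G)} {x v} → x ∈ S → Incident G v x →
    ∣ S ∩ star G v ∣ ≤ d → rank (M 𝓜 G) (S - x) < rank (M 𝓜 G) S
  sparse-at-endpoint⇒coloop G {S} {x} {v} x∈S v-x sparse = ≰⇒> λ x-spanned →
    no-circuit-through-x (circuit-through S x∈S x-spanned)
    where
    open MatroidProperties (M 𝓜 G)
    no-circuit-through-x : ¬ (∃ λ C → C ⊆ S × x ∈ C × Circuit C)
    no-circuit-through-x (C , C⊆S , x∈C , circuit) = 1+n≰n (begin
      suc d                        ≤⟨ s≤s (d-least δ (H , Circuit⇒IsCircuit 𝓜 circuit , minDeg)) ⟩
      suc δ                        ≤⟨ proj₁ minDeg v∈H ⟩
      degree H v∈H                 ≤⟨ degreeH≤ v∈H ⟩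
      ∣ C ∩ star G (vertex v∈H) ∣  ≡⟨ cong (λ w → ∣ C ∩ star G w ∣) (enum-index (covered⁺ x∈C v-x)) ⟩
      ∣ C ∩ star G v ∣             ≤⟨ p⊆q⇒∣p∣≤∣q∣ C∩star⊆S∩star ⟩
      ∣ S ∩ star G v ∣             ≤⟨ sparse ⟩
      d                            ∎)
      where
      open ≤-Reasoning
      open EdgeInducedSubgraph G C
      v∈H : Fin (n H)
      v∈H = index (covered⁺ x∈C v-x)
      δ : ℕ
      δ = proj₁ (minimum-degree H v∈H)
      minDeg : MinDegree H (suc δ)
      minDeg = proj₂ (minimum-degree H v∈H)
      C∩star⊆S∩star : C ∩ star G v ⊆ S ∩ star G v
      C∩star⊆S∩star y∈ = let y∈C , y∈star = x∈p∩q⁻ C _ y∈ in x∈p∩q⁺ (C⊆S y∈C , y∈star)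

  ρ∁[star─B]<ρ⊤ : ∀ G v {B e} → ∣ B ∣ < d → e ∈ star G v ─ B →
    rank (M 𝓜 G) (∁ (star G v ─ B)) < rank (M 𝓜 G) ⊤
  ρ∁[star─B]<ρ⊤ G v {B} {e} ∣B∣<d e∈A = begin-strict
    ρ (∁ A)                  ≤⟨ ρ-mono ∁A⊆S-e ⟩
    ρ (S - e)                <⟨ sparse-at-endpoint⇒coloop G (q⊆p∪q (∁ A) ⁅ e ⁆ (x∈⁅x⁆ e))
                                  (∈-setOf⁻ (incident? G v) (p─q⊆p (star G v) B e∈A)) sparse ⟩
    ρ S                      ≤⟨ ρ-mono ⊆⊤ ⟩
    ρ ⊤                      ∎
    where
    open ≤-Reasoning
    open MatroidProperties (M 𝓜 G)
    A : Subset (m G)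
    A = star G v ─ B
    S : Subset (m G)
    S = ∁ A ∪ ⁅ e ⁆
    S∩star⊆B∪e : S ∩ star G v ⊆ B ∪ ⁅ e ⁆
    S∩star⊆B∪e {y} y∈S∩star with x∈p∩q⁻ S _ y∈S∩star
    ... | y∈S , y∈star with x∈p∪q⁻ (∁ A) ⁅ e ⁆ y∈S | y ∈? B
    ...   | inj₂ y∈e | _ = q⊆p∪q B ⁅ e ⁆ y∈e
    ...   | inj₁ _ | yes y∈B = p⊆p∪q ⁅ e ⁆ y∈B
    ...   | inj₁ y∈∁A | no y∉B = contradiction (x∈p∧x∉q⇒x∈p─q y∈star y∉B) (x∈∁p⇒x∉p y∈∁A)
    sparse : ∣ S ∩ star G v ∣ ≤ d
    sparse = begin
      ∣ S ∩ star G v ∣         ≤⟨ p⊆q⇒∣p∣≤∣q∣ S∩star⊆B∪e ⟩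
      ∣ B ∪ ⁅ e ⁆ ∣            ≤⟨ ∣p∪q∣≤∣p∣+∣q∣ B ⁅ e ⁆ ⟩
      ∣ B ∣ + ∣ ⁅ e ⁆ ∣        ≡⟨ cong (∣ B ∣ +_) (∣⁅x⁆∣≡1 e) ⟩
      ∣ B ∣ + 1                ≡⟨ +-comm ∣ B ∣ 1 ⟩
      suc ∣ B ∣                ≤⟨ ∣B∣<d ⟩
      d                        ∎
    ∁A⊆S-e : ∁ A ⊆ S - e
    ∁A⊆S-e y∈∁A = x∈p∧x≢y⇒x∈p-y (p⊆p∪q ⁅ e ⁆ y∈∁A) λ { refl → x∈∁p⇒x∉p y∈∁A e∈A }

  degree≢small-split : ∀ G {c} → VerticallyConnected (M 𝓜 G) c → ∀ v →
    ¬ (∃ λ j → ∃ λ a → j + a ≡ degree G v × j < d × 0 < a × a < c)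
  degree≢small-split G {c} connected v (j , a , j+a≡degree , j<d , 0<a , a<c)
    with split-by-size j a (star G v) (trans (∣star∣≡degree G v) (sym j+a≡degree))
  ... | B , _ , ∣B∣≡j , ∣A∣≡a with ∣p∣>0⇒Nonempty (subst (0 <_) (sym ∣A∣≡a) 0<a)
  ...   | e , e∈A = MatroidProperties.low-rank-side⇒¬VerticallyConnected (M 𝓜 G) (star G v ─ B)
                      (≤-<-trans (rank-≤ (M 𝓜 G) _) (subst (_< c) (sym ∣A∣≡a) a<c))
                      (ρ∁[star─B]<ρ⊤ G v (subst (_< d) (sym ∣B∣≡j) j<d) e∈A)
                      connected

  degree-bound : ∀ G {c} → 2 ≤ c → 0 < d → VerticallyConnected (M 𝓜 G) c → ∀ v → c + d ∸ 1 ≤ degree G v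
  degree-bound G 2≤c 0<d connected v =
    ≮⇒≥ (degree≢small-split G connected v ∘ small-split (degree>0 G v) 0<d 2≤c)

lemma3p4 : (𝓜 : GraphMatroidFamily) → Nontrivial 𝓜 → Unbounded 𝓜 →
    (d : ℕ) → IsDimensionality 𝓜 d → (k : ℕ) → 2 ≤ k → (G : Graph) →
    VerticallyConnected (M 𝓜 G) k →
    (∀ v → k + d ∸ 1 ≤ degree G v) × (k + d ≤ n G)
lemma3p4 𝓜 _ unbounded d (dimension-d-circuit , d-least) k 2≤k G connected = degree≥ , k+d≤n
  where
  degree≥ : ∀ v → k + d ∸ 1 ≤ degree G v
  degree≥ = degree-bound 𝓜 d-least G 2≤k (dimensionality-positive 𝓜 unbounded dimension-d-circuit) connected
  some-edge : Fin (m G)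
  some-edge = fromℕ< (<-≤-trans (<-≤-trans z<s 2≤k)
    (≤-trans (proj₁ connected) (MatroidProperties.ρ⊤≤k (M 𝓜 G))))
  v₀ : Fin (n G)
  v₀ = proj₁ (ends G some-edge)
  k+d≤n : k + d ≤ n G
  k+d≤n = ≤-trans (m≤n+m∸n (k + d) 1) (≤-trans (s≤s (degree≥ v₀)) (degree<n G v₀))
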